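{- If $P$ is a poset and $P^*$ is its dual poset, then $U_P=U_{P^*}$. Consequently, neither the number of minimal elements nor the number of maximal elements of a poset $P$ is determined by $U_P$.
   Context: For a digraph $X=(V,E)$ (finite $V$, $E\subseteq V\times V$) with $|V|=n$, a $V$-listing is a bijection $\pi:[n]\to V$, written $(\pi_1,\dots,\pi_n)$. Its $X$-descent set is $X\mathrm{Des}(\pi)=\{i\in[n-1]:(\pi_i,\pi_{i+1})\in E\}$. For $I\subseteq[n-1]$, the fundamental quasisymmetric function is $F_I=\sum x_{i_1}\cdots x_{i_n}$, summed over $1\le i_1\le\dots\le i_n$ with $i_j<i_{j+1}$ for $j\in I$. The Redei-Berge function is $U_X=\sum_\pi F_{X\mathrm{Des}(\pi)}$ over all $V$-listings. For a poset $P$ on a finite set, $U_P:=U_{D_P}$, where $D_P$ has the elements of $P$ as vertices and edges $(i,j)$ whenever $i<_Pj$. The dual poset $P^*$ has $i<_{P^*}j$ if and only if $j<_Pi$. -}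

module Defs where

open import Data.Nat using (ℕ; zero; suc; _≡ᵇ_; _<ᵇ_; _≤ᵇ_)
open import Data.Fin using (Fin; toℕ; _≟_)
open import Data.Fin.Properties using (any?)
open import Data.Bool using (Bool; true; false; if_then_else_; _∧_; not)
open import Data.List using (List; []; _∷_; map; concatMap; length; filterᵇ; cartesianProduct; allFin)
open import Data.Bool.ListAction using (and)
open import Data.Product using (_×_; _,_; Σ)
open import Function using (flip)
open import Relation.Binary using (Decidable; IsPartialOrder)
open import Relation.Binary.PropositionalEquality using (_≡_)
import Relation.Binary.Construct.Flip.EqAndOrd as Flip
open import Relation.Nullary using (¬_; does)
open import Relation.Nullary.Decidable using (_×-dec_; ¬?)

inserts : {A : Set} → A → List A → List (List A)
inserts x [] = (x ∷ []) ∷ []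
inserts x (y ∷ ys) = (x ∷ y ∷ ys) ∷ map (y ∷_) (inserts x ys)

perms : {A : Set} → List A → List (List A)
perms [] = [] ∷ []
perms (x ∷ xs) = concatMap (inserts x) (perms xs)

listings : (n : ℕ) → List (List (Fin n))
listings n = perms (allFin n)

words : (m k : ℕ) → List (List (Fin m))
words m zero = [] ∷ []
words m (suc k) = concatMap (λ w → map (_∷ w) (allFin m)) (words m k)

-- i₁ ≤ … ≤ iₙ, with i_j < i_{j+1} whenever (π_j , π_{j+1}) ∈ E (i.e. j ∈ XDes π)
compatible : {n m : ℕ} (E : Fin n → Fin n → Set) → Decidable E →
             List (Fin n) → List (Fin m) → Bool
compatible E E? (a ∷ b ∷ π) (i ∷ j ∷ s) =
  (if does (E? a b) then toℕ i <ᵇ toℕ j else toℕ i ≤ᵇ toℕ j)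
  ∧ compatible E E? (b ∷ π) (j ∷ s)
compatible E E? _ _ = true

-- the monomial x_{i₁}⋯x_{iₙ} equals x^α, α : Fin m → ℕ the exponent vector
hasContent : {m : ℕ} → (Fin m → ℕ) → List (Fin m) → Bool
hasContent {m} α w =
  and (map (λ j → length (filterᵇ (λ x → does (x ≟ j)) w) ≡ᵇ α j) (allFin m))

-- coefficient of the monomial x_0^{α 0} ⋯ x_{m-1}^{α (m-1)} in the Redei–Berge
-- function U_X = Σ_π F_{XDes π} of the digraph X = (Fin n, E).
-- Every monomial in countably many variables is of this form for some m, α.
UCoeff : {n : ℕ} (E : Fin n → Fin n → Set) → Decidable E →
         (m : ℕ) → (Fin m → ℕ) → ℕ
UCoeff {n} E E? m α =
  length (filterᵇ (λ p → compatible E E? (Data.Product.proj₁ p) (Data.Product.proj₂ p)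
                          ∧ hasContent α (Data.Product.proj₂ p))
                  (cartesianProduct (listings n) (words m n)))

record FinPoset : Set₁ where
  field
    size  : ℕ
    _≤P_  : Fin size → Fin size → Set
    isPO  : IsPartialOrder _≡_ _≤P_
    _≤P?_ : Decidable _≤P_

open FinPoset public

StrictLt : (P : FinPoset) → Fin (size P) → Fin (size P) → Set
StrictLt P i j = _≤P_ P i j × ¬ (i ≡ j)

StrictLt? : (P : FinPoset) → Decidable (StrictLt P)
StrictLt? P i j = _≤P?_ P i j ×-dec ¬? (i ≟ j)

UPCoeff : (P : FinPoset) → (m : ℕ) → (Fin m → ℕ) → ℕ
UPCoeff P = UCoeff (StrictLt P) (StrictLt? P)

SameU : FinPoset → FinPoset → Set
SameU P Q = (m : ℕ) (α : Fin m → ℕ) → UPCoeff P m α ≡ UPCoeff Q m α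

dual : FinPoset → FinPoset
dual P = record
  { size = size P
  ; _≤P_ = flip (_≤P_ P)
  ; isPO = Flip.isPartialOrder (isPO P)
  ; _≤P?_ = flip (_≤P?_ P)
  }

numMinimal : FinPoset → ℕ
numMinimal P = length (filterᵇ (λ i → not (does (any? (λ j → StrictLt? P j i)))) (allFin (size P)))

numMaximal : FinPoset → ℕ
numMaximal P = length (filterᵇ (λ i → not (does (any? (λ j → StrictLt? P i j)))) (allFin (size P)))

-- Compatibility of a listing π with a word w asks, inside each run of equal letters of w,
-- that no two consecutive entries of π form an edge, and between runs only that the letters
-- increase. Reversing π within every run of w therefore exchanges the listings compatible
-- with w for X and for the reversed digraph X^op; as this block reversal is an involution on
-- listings, U_X = U_{X^op}. Since D_{P*} = (D_P)^op, U_P = U_{P*}. A bottom element below a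
-- two-element antichain gives a poset with one minimal and two maximal elements, and its
-- dual has the opposite counts.
module Submission where

open import Defs
open import Data.Bool using (Bool; true; false; _∧_; not; if_then_else_)
open import Data.Bool.Properties using (∧-assoc; ∧-comm; ∧-identityʳ)
open import Data.Empty using (⊥-elim)
open import Data.Fin using (Fin; zero; toℕ; _≟_)
open import Data.Fin.Properties using (toℕ-injective)
open import Data.List
  using (List; []; _∷_; _++_; [_]; map; concatMap; length; filterᵇ; reverse; _ʳ++_;
         take; drop; replicate; allFin; cartesianProduct)
open import Data.List.Properties
  using (length-map; length-reverse; length-take; length-++-comm; length-tabulate; take-all; drop-all;
         take++drop≡id; reverse-involutive; ++-identityʳ; ++-assoc; ∷-injectiveˡ; ∷-injectiveʳ)
open import Data.List.Membership.Propositional using (_∈_; _∉_; find; lose)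
open import Data.List.Membership.Propositional.Properties
  using (∈-map⁺; ∈-map⁻; ∈-concatMap⁺; ∈-concatMap⁻; ∈-∃++; ∈-cartesianProduct⁺; ∈-cartesianProduct⁻)
open import Data.List.Membership.Propositional.Properties.WithK using (unique∧set⇒bag)
open import Data.List.Relation.Unary.Any using (here; there)
open import Data.List.Relation.Unary.All as All using (All; []; _∷_)
open import Data.List.Relation.Unary.AllPairs using ([]; _∷_)
open import Data.List.Relation.Unary.Unique.Propositional using (Unique)
open import Data.List.Relation.Unary.Unique.Propositional.Properties as Unique
  using (allFin⁺; cartesianProduct⁺)
open import Data.List.Relation.Binary.BagAndSetEquality using (∼bag⇒↭)
open import Data.List.Relation.Binary.Permutation.Propositional
  using (_↭_; ↭-refl; ↭-sym; ↭-trans; ↭-prep; ↭-swap; ↭-reflexive)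
open import Data.List.Relation.Binary.Permutation.Propositional.Properties
  using (↭-length; ↭-reverse; ++⁺; filter-↭; ∈-resp-↭; drop-mid; ¬x∷xs↭[])
open import Data.Nat using (ℕ; zero; suc; _≤_; _<ᵇ_; _≤ᵇ_)
open import Data.Nat.Properties
  using (≤-refl; n≮n; <⇒≤; ≤∧≢⇒<; <ᵇ-reflects-<; ≤ᵇ-reflects-≤; ≤ᵇ⇒≤; ≤⇒≤ᵇ; suc-injective;
         _≤?_; m≤n⇒m⊓n≡m; ≰⇒>)
open import Data.Product using (_×_; Σ; _,_; proj₁; proj₂)
open import Data.Sum using (_⊎_; inj₁; inj₂)
open import Function using (_∘_; flip)
open import Function.Bundles using (mk⇔)
open import Relation.Binary using (Decidable; DecidableEquality)
open import Relation.Binary.PropositionalEquality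
  using (_≡_; _≢_; refl; sym; trans; cong; cong₂; subst; subst₂; isEquivalence; module ≡-Reasoning)
open import Relation.Nullary using (yes; no; does; ¬_)
open import Relation.Nullary.Decidable using (T?; _⊎-dec_; map′; does-≡)
open import Relation.Nullary.Reflects using (ofʸ; ofⁿ; det; fromEquivalence)

open ≡-Reasoning

module _ {A : Set} where

  filterᵇ-cong-∈ : {p q : A → Bool} (xs : List A) →
                   (∀ {x} → x ∈ xs → p x ≡ q x) → filterᵇ p xs ≡ filterᵇ q xs
  filterᵇ-cong-∈ [] _ = refl
  filterᵇ-cong-∈ {p} {q} (x ∷ xs) p≗q with p x | q x | p≗q (here refl)
  ... | true  | true  | _ = cong (x ∷_) (filterᵇ-cong-∈ xs (p≗q ∘ there))
  ... | false | false | _ = filterᵇ-cong-∈ xs (p≗q ∘ there)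

  filterᵇ-map : {B : Set} (p : B → Bool) (f : A → B) (xs : List A) →
                filterᵇ p (map f xs) ≡ map f (filterᵇ (p ∘ f) xs)
  filterᵇ-map p f [] = refl
  filterᵇ-map p f (x ∷ xs) with p (f x)
  ... | true  = cong (f x ∷_) (filterᵇ-map p f xs)
  ... | false = filterᵇ-map p f xs

  map-involution-↭ : {f : A → A} {xs : List A} → Unique xs →
                     (∀ {x} → x ∈ xs → f x ∈ xs) → (∀ x → f (f x) ≡ x) → map f xs ↭ xs
  map-involution-↭ {f} {xs} xs! f∈ ff =
    ∼bag⇒↭ (unique∧set⇒bag (Unique.map⁺ f-injective xs!) xs! (mk⇔ to from))
    where
    f-injective : ∀ {x y} → f x ≡ f y → x ≡ y
    f-injective {x} {y} fx≡fy = trans (sym (ff x)) (trans (cong f fx≡fy) (ff y))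
    to : ∀ {z} → z ∈ map f xs → z ∈ xs
    to z∈ with _ , x∈ , refl ← ∈-map⁻ f z∈ = f∈ x∈
    from : ∀ {z} → z ∈ xs → z ∈ map f xs
    from {z} z∈ = subst (_∈ map f xs) (ff z) (∈-map⁺ f (f∈ z∈))

  length-filterᵇ-involution : {p q : A → Bool} {f : A → A} {xs : List A} → Unique xs →
    (∀ {x} → x ∈ xs → f x ∈ xs) → (∀ x → f (f x) ≡ x) → (∀ {x} → x ∈ xs → p x ≡ q (f x)) →
    length (filterᵇ p xs) ≡ length (filterᵇ q xs)
  length-filterᵇ-involution {p} {q} {f} {xs} xs! f∈ ff p≗q∘f = begin
    length (filterᵇ p xs)                 ≡⟨ cong length (filterᵇ-cong-∈ xs p≗q∘f) ⟩
    length (filterᵇ (q ∘ f) xs)           ≡⟨ sym (length-map f (filterᵇ (q ∘ f) xs)) ⟩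
    length (map f (filterᵇ (q ∘ f) xs))   ≡⟨ cong length (sym (filterᵇ-map q f xs)) ⟩
    length (filterᵇ q (map f xs))         ≡⟨ ↭-length (filter-↭ (T? ∘ q) (map-involution-↭ xs! f∈ ff)) ⟩
    length (filterᵇ q xs)                 ∎

  concatMap-unique : {B : Set} (f : B → List A) (g : A → B) (bs : List B) →
    (∀ {b z} → b ∈ bs → z ∈ f b → g z ≡ b) → All (Unique ∘ f) bs → Unique bs → Unique (concatMap f bs)
  concatMap-unique f g [] _ _ _ = []
  concatMap-unique f g (b ∷ bs) g∘f (fb! ∷ fbs!) (b∉ ∷ bs!) =
    Unique.++⁺ fb! (concatMap-unique f g bs (g∘f ∘ there) fbs! bs!) disjoint
    where
    disjoint : ∀ {z} → ¬ (z ∈ f b × z ∈ concatMap f bs)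
    disjoint (z∈ , z∈′) with b′ , b′∈ , z∈b′ ← find (∈-concatMap⁻ f {xs = bs} z∈′) =
      All.lookup b∉ b′∈ (trans (sym (g∘f (here refl) z∈)) (g∘f (there b′∈) z∈b′))

  ∈-inserts : (x : A) (us vs : List A) → us ++ x ∷ vs ∈ inserts x (us ++ vs)
  ∈-inserts x [] [] = here refl
  ∈-inserts x [] (v ∷ vs) = here refl
  ∈-inserts x (u ∷ us) vs = there (∈-map⁺ (u ∷_) (∈-inserts x us vs))

  inserts-↭ : (x : A) (ys : List A) {zs : List A} → zs ∈ inserts x ys → zs ↭ x ∷ ys
  inserts-↭ x [] (here refl) = ↭-refl
  inserts-↭ x (y ∷ ys) (here refl) = ↭-refl
  inserts-↭ x (y ∷ ys) (there zs∈) with ts , ts∈ , refl ← ∈-map⁻ (y ∷_) zs∈ =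
    ↭-trans (↭-prep y (inserts-↭ x ys ts∈)) (↭-swap y x ↭-refl)

  inserts-unique : (x : A) (ys : List A) → x ∉ ys → Unique (inserts x ys)
  inserts-unique x [] _ = [] ∷ []
  inserts-unique x (y ∷ ys) x∉ =
    All.tabulate head-new ∷ Unique.map⁺ ∷-injectiveʳ (inserts-unique x ys (x∉ ∘ there))
    where
    head-new : ∀ {zs} → zs ∈ map (y ∷_) (inserts x ys) → x ∷ y ∷ ys ≢ zs
    head-new zs∈ eq with _ , _ , refl ← ∈-map⁻ (y ∷_) zs∈ = x∉ (here (∷-injectiveˡ eq))

  ∈-perms⇒↭ : (xs : List A) {ys : List A} → ys ∈ perms xs → ys ↭ xs
  ∈-perms⇒↭ [] (here refl) = ↭-refl
  ∈-perms⇒↭ (x ∷ xs) ys∈ with zs , zs∈ , ys∈′ ← find (∈-concatMap⁻ (inserts x) {xs = perms xs} ys∈) =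
    ↭-trans (inserts-↭ x zs ys∈′) (↭-prep x (∈-perms⇒↭ xs zs∈))

  ↭⇒∈-perms : (xs : List A) {ys : List A} → ys ↭ xs → ys ∈ perms xs
  ↭⇒∈-perms [] {[]} _ = here refl
  ↭⇒∈-perms [] {y ∷ ys} ys↭[] = ⊥-elim (¬x∷xs↭[] ys↭[])
  ↭⇒∈-perms (x ∷ xs) ys↭ with us , vs , refl ← ∈-∃++ (∈-resp-↭ (↭-sym ys↭) (here refl)) =
    ∈-concatMap⁺ (inserts x) {xs = perms xs}
      (lose (↭⇒∈-perms xs (drop-mid us [] ys↭)) (∈-inserts x us vs))

module _ {A : Set} (_≟A_ : DecidableEquality A) where

  delete : A → List A → List A
  delete x [] = []
  delete x (y ∷ ys) with x ≟A y
  ... | yes _ = ys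
  ... | no _  = y ∷ delete x ys

  delete-head : (x : A) (ys : List A) → delete x (x ∷ ys) ≡ ys
  delete-head x ys with x ≟A x
  ... | yes _  = refl
  ... | no x≢x = ⊥-elim (x≢x refl)

  delete-inserts : (x : A) (ys : List A) → x ∉ ys → ∀ {zs} → zs ∈ inserts x ys → delete x zs ≡ ys
  delete-inserts x [] _ (here refl) = delete-head x []
  delete-inserts x (y ∷ ys) _ (here refl) = delete-head x (y ∷ ys)
  delete-inserts x (y ∷ ys) x∉ (there zs∈) with ts , ts∈ , refl ← ∈-map⁻ (y ∷_) zs∈ | x ≟A y
  ... | yes refl = ⊥-elim (x∉ (here refl))
  ... | no _     = cong (y ∷_) (delete-inserts x ys (x∉ ∘ there) ts∈)

  perms-unique : (xs : List A) → Unique xs → Unique (perms xs)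
  perms-unique [] _ = [] ∷ []
  perms-unique (x ∷ xs) (x∉ ∷ xs!) =
    concatMap-unique (inserts x) (delete x) (perms xs)
      (λ ys∈ → delete-inserts x _ (x∉perm ys∈))
      (All.tabulate (λ ys∈ → inserts-unique x _ (x∉perm ys∈)))
      (perms-unique xs xs!)
    where
    x∉perm : ∀ {ys} → ys ∈ perms xs → x ∉ ys
    x∉perm ys∈ x∈ = All.lookup x∉ (∈-resp-↭ (∈-perms⇒↭ xs ys∈) x∈) refl

length-listings : (n : ℕ) {π : List (Fin n)} → π ∈ listings n → length π ≡ n
length-listings n π∈ = trans (↭-length (∈-perms⇒↭ (allFin n) π∈)) (length-tabulate (λ i → i))

length-words : (m k : ℕ) {w : List (Fin m)} → w ∈ words m k → length w ≡ k
length-words m zero (here refl) = refl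
length-words m (suc k) w∈
  with v , v∈ , w∈′ ← find (∈-concatMap⁻ (λ v → map (_∷ v) (allFin m)) {xs = words m k} w∈)
  with _ , _ , refl ← ∈-map⁻ (_∷ v) w∈′ = cong suc (length-words m k v∈)

words-unique : (m k : ℕ) → Unique (words m k)
words-unique m zero = [] ∷ []
words-unique m (suc k) =
  concatMap-unique (λ v → map (_∷ v) (allFin m)) (drop 1) (words m k) drop-head
    (All.tabulate (λ _ → Unique.map⁺ ∷-injectiveˡ (allFin⁺ m))) (words-unique m k)
  where
  drop-head : ∀ {v w} → v ∈ words m k → w ∈ map (_∷ v) (allFin m) → drop 1 w ≡ v
  drop-head _ w∈ with _ , _ , refl ← ∈-map⁻ (_∷ _) w∈ = refl

replicate-∷-++ : {B : Set} (k : ℕ) (c : B) (w : List B) → c ∷ replicate k c ++ w ≡ replicate k c ++ c ∷ w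
replicate-∷-++ zero    c w = refl
replicate-∷-++ (suc k) c w = cong (c ∷_) (replicate-∷-++ k c w)

module _ {A : Set} where

  reverseChunks : List ℕ → List A → List A
  reverseChunks []       π = π
  reverseChunks (k ∷ ks) π = reverse (take k π) ++ reverseChunks ks (drop k π)

  reverseChunks-↭ : (ks : List ℕ) (π : List A) → reverseChunks ks π ↭ π
  reverseChunks-↭ [] π = ↭-refl
  reverseChunks-↭ (k ∷ ks) π =
    ↭-trans (++⁺ (↭-reverse (take k π)) (reverseChunks-↭ ks (drop k π))) (↭-reflexive (take++drop≡id k π))

  reverseChunks-≢[] : (ks : List ℕ) {a : A} (π : List A) → reverseChunks ks (a ∷ π) ≢ []
  reverseChunks-≢[] ks π eq = ¬x∷xs↭[] (subst (_ ↭_) eq (↭-sym (reverseChunks-↭ ks _)))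

  reverseChunks-[] : (ks : List ℕ) → reverseChunks ks [] ≡ []
  reverseChunks-[] [] = refl
  reverseChunks-[] (zero ∷ ks) = reverseChunks-[] ks
  reverseChunks-[] (suc k ∷ ks) = reverseChunks-[] ks

  take-drop-++ : {k : ℕ} (s t : List A) → length s ≡ k → take k (s ++ t) ≡ s × drop k (s ++ t) ≡ t
  take-drop-++ [] t refl = refl , refl
  take-drop-++ (x ∷ s) t refl with take-s , drop-t ← take-drop-++ s t refl = cong (x ∷_) take-s , drop-t

  reverseChunks-++ : (ks : List ℕ) {k : ℕ} (s t : List A) → length s ≡ k →
                     reverseChunks (k ∷ ks) (s ++ t) ≡ reverse s ++ reverseChunks ks t
  reverseChunks-++ ks s t ∣s∣ with take-s , drop-t ← take-drop-++ s t ∣s∣ =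
    cong₂ (λ u v → reverse u ++ reverseChunks ks v) take-s drop-t

  reverseChunks-short : (ks : List ℕ) {k : ℕ} (π : List A) → length π ≤ k →
                        reverseChunks (k ∷ ks) π ≡ reverse π
  reverseChunks-short ks {k} π ∣π∣≤k = begin
    reverse (take k π) ++ reverseChunks ks (drop k π)
      ≡⟨ cong₂ (λ u v → reverse u ++ reverseChunks ks v) (take-all k π ∣π∣≤k) (drop-all k π ∣π∣≤k) ⟩
    reverse π ++ reverseChunks ks []
      ≡⟨ cong (reverse π ++_) (reverseChunks-[] ks) ⟩
    reverse π ++ []
      ≡⟨ ++-identityʳ _ ⟩
    reverse π ∎

  reverseChunks-involutive : (ks : List ℕ) (π : List A) → reverseChunks ks (reverseChunks ks π) ≡ π
  reverseChunks-involutive [] π = refl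
  reverseChunks-involutive (k ∷ ks) π with k ≤? length π
  ... | yes k≤∣π∣ = begin
    reverseChunks (k ∷ ks) (reverse (take k π) ++ reverseChunks ks (drop k π))
      ≡⟨ reverseChunks-++ ks (reverse (take k π)) _ ∣reverse-take∣ ⟩
    reverse (reverse (take k π)) ++ reverseChunks ks (reverseChunks ks (drop k π))
      ≡⟨ cong₂ _++_ (reverse-involutive (take k π)) (reverseChunks-involutive ks (drop k π)) ⟩
    take k π ++ drop k π
      ≡⟨ take++drop≡id k π ⟩
    π ∎
    where
    ∣reverse-take∣ : length (reverse (take k π)) ≡ k
    ∣reverse-take∣ = trans (length-reverse (take k π)) (trans (length-take k π) (m≤n⇒m⊓n≡m k≤∣π∣))
  ... | no k≰∣π∣ = begin
    reverseChunks (k ∷ ks) (reverseChunks (k ∷ ks) π)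
      ≡⟨ cong (reverseChunks (k ∷ ks)) (reverseChunks-short ks π ∣π∣≤k) ⟩
    reverseChunks (k ∷ ks) (reverse π)
      ≡⟨ reverseChunks-short ks (reverse π) (subst (_≤ k) (sym (length-reverse π)) ∣π∣≤k) ⟩
    reverse (reverse π)
      ≡⟨ reverse-involutive π ⟩
    π ∎
    where
    ∣π∣≤k : length π ≤ k
    ∣π∣≤k = <⇒≤ (≰⇒> k≰∣π∣)

module _ {m : ℕ} where

  -- runLengthsFrom c k w lists the lengths of the maximal runs of  replicate k c ++ w.
  runLengthsFrom : Fin m → ℕ → List (Fin m) → List ℕ
  runLengthsFrom c k [] = k ∷ []
  runLengthsFrom c k (i ∷ w) with c ≟ i
  ... | yes _ = runLengthsFrom c (suc k) w
  ... | no _  = k ∷ runLengthsFrom i 1 w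

  runLengths : List (Fin m) → List ℕ
  runLengths []      = []
  runLengths (c ∷ w) = runLengthsFrom c 1 w

  reverseRuns : {A : Set} → List (Fin m) → List A → List A
  reverseRuns w = reverseChunks (runLengths w)

ascent-refl : (d : Bool) (c : ℕ) → (if d then c <ᵇ c else c ≤ᵇ c) ≡ not d
ascent-refl true  c = det (<ᵇ-reflects-< c c) (ofⁿ (n≮n c))
ascent-refl false c = det (≤ᵇ-reflects-≤ c c) (ofʸ ≤-refl)

ascent-≢ : (d : Bool) {c i : ℕ} → c ≢ i → (if d then c <ᵇ i else c ≤ᵇ i) ≡ (c ≤ᵇ i)
ascent-≢ true  {c} {i} c≢i =
  det (<ᵇ-reflects-< c i) (fromEquivalence (λ c≤ᵇi → ≤∧≢⇒< (≤ᵇ⇒≤ c i c≤ᵇi) c≢i) (≤⇒≤ᵇ ∘ <⇒≤))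
ascent-≢ false _ = refl

edgeFree : {A : Set} {E : A → A → Set} → Decidable E → List A → Bool
edgeFree E? (a ∷ b ∷ s) = not (does (E? a b)) ∧ edgeFree E? (b ∷ s)
edgeFree E? _           = true

module _ {A : Set} {E : A → A → Set} (E? : Decidable E) where

  edgeFree-ʳ++ : (a : A) (acc s : List A) →
                 edgeFree E? (s ʳ++ a ∷ acc) ≡ edgeFree (flip E?) (a ∷ s) ∧ edgeFree E? (a ∷ acc)
  edgeFree-ʳ++ a acc [] = refl
  edgeFree-ʳ++ a acc (b ∷ s) = begin
    edgeFree E? (s ʳ++ b ∷ a ∷ acc)
      ≡⟨ edgeFree-ʳ++ b (a ∷ acc) s ⟩
    edgeFree (flip E?) (b ∷ s) ∧ (not (does (E? b a)) ∧ edgeFree E? (a ∷ acc))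
      ≡⟨ sym (∧-assoc (edgeFree (flip E?) (b ∷ s)) _ _) ⟩
    (edgeFree (flip E?) (b ∷ s) ∧ not (does (E? b a))) ∧ edgeFree E? (a ∷ acc)
      ≡⟨ cong (_∧ edgeFree E? (a ∷ acc)) (∧-comm (edgeFree (flip E?) (b ∷ s)) _) ⟩
    edgeFree (flip E?) (a ∷ b ∷ s) ∧ edgeFree E? (a ∷ acc) ∎

  edgeFree-reverse : (s : List A) → edgeFree E? (reverse s) ≡ edgeFree (flip E?) s
  edgeFree-reverse [] = refl
  edgeFree-reverse (a ∷ s) = trans (edgeFree-ʳ++ a [] s) (∧-identityʳ _)

module _ {n m : ℕ} {E : Fin n → Fin n → Set} (E? : Decidable E) where

  compatible-replicate : {k : ℕ} {c : Fin m} (s : List (Fin n)) → length s ≡ k →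
                         compatible E E? s (replicate k c) ≡ edgeFree E? s
  compatible-replicate [] refl = refl
  compatible-replicate (a ∷ []) refl = refl
  compatible-replicate {c = c} (a ∷ b ∷ s) refl =
    cong₂ _∧_ (ascent-refl (does (E? a b)) (toℕ c)) (compatible-replicate (b ∷ s) refl)

  compatible-++-run : {k : ℕ} {c i : Fin m} {w : List (Fin m)} → c ≢ i →
    (s t : List (Fin n)) → length s ≡ suc k → t ≢ [] →
    compatible E E? (s ++ t) (replicate (suc k) c ++ i ∷ w)
      ≡ edgeFree E? s ∧ ((toℕ c ≤ᵇ toℕ i) ∧ compatible E E? t (i ∷ w))
  compatible-++-run _ _ [] _ t≢[] = ⊥-elim (t≢[] refl)
  compatible-++-run {zero} {c} {i} c≢i (a ∷ []) (b ∷ t) refl _ =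
    cong (_∧ compatible E E? (b ∷ t) (i ∷ _)) (ascent-≢ (does (E? a b)) (c≢i ∘ toℕ-injective))
  compatible-++-run {suc k} {c} c≢i (a ∷ b ∷ s) t refl t≢[] = begin
    ascent ∧ compatible E E? (b ∷ s ++ t) (replicate (suc k) c ++ _)
      ≡⟨ cong (ascent ∧_) (compatible-++-run c≢i (b ∷ s) t refl t≢[]) ⟩
    ascent ∧ (edgeFree E? (b ∷ s) ∧ _)
      ≡⟨ ∧-assoc ascent _ _ ⟨
    (ascent ∧ edgeFree E? (b ∷ s)) ∧ _
      ≡⟨ cong (λ x → (x ∧ edgeFree E? (b ∷ s)) ∧ _) (ascent-refl (does (E? a b)) (toℕ c)) ⟩
    edgeFree E? (a ∷ b ∷ s) ∧ _ ∎
    where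
    ascent = if does (E? a b) then toℕ c <ᵇ toℕ c else toℕ c ≤ᵇ toℕ c

module _ {n m : ℕ} {E : Fin n → Fin n → Set} where

  compatible-reverse-replicate : (E? : Decidable E) {k : ℕ} {c : Fin m} (s : List (Fin n)) → length s ≡ k →
    compatible E E? s (replicate k c) ≡ compatible (flip E) (flip E?) (reverse s) (replicate k c)
  compatible-reverse-replicate E? s ∣s∣ = begin
    compatible E E? s (replicate _ _)
      ≡⟨ compatible-replicate E? s ∣s∣ ⟩
    edgeFree E? s
      ≡⟨ edgeFree-reverse (flip E?) s ⟨
    edgeFree (flip E?) (reverse s)
      ≡⟨ compatible-replicate (flip E?) (reverse s) (trans (length-reverse s) ∣s∣) ⟨
    compatible (flip E) (flip E?) (reverse s) (replicate _ _) ∎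

  compatible-reverseRunsFrom : (E? : Decidable E) (c : Fin m) (k : ℕ) (w : List (Fin m)) (s t : List (Fin n)) →
    length s ≡ suc k → length t ≡ length w →
    compatible E E? (s ++ t) (replicate (suc k) c ++ w)
      ≡ compatible (flip E) (flip E?) (reverseChunks (runLengthsFrom c (suc k) w) (s ++ t)) (replicate (suc k) c ++ w)
  compatible-reverseRunsFrom E? c k [] s [] ∣s∣ refl = begin
    compatible E E? (s ++ []) (run ++ [])
      ≡⟨ cong₂ (compatible E E?) (++-identityʳ s) (++-identityʳ run) ⟩
    compatible E E? s run
      ≡⟨ compatible-reverse-replicate E? s ∣s∣ ⟩
    compatible (flip E) (flip E?) (reverse s) run
      ≡⟨ cong₂ (compatible (flip E) (flip E?)) reverseChunks-s (++-identityʳ run) ⟨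
    compatible (flip E) (flip E?) (reverseChunks (suc k ∷ []) (s ++ [])) (run ++ []) ∎
    where
    run = replicate (suc k) c
    reverseChunks-s : reverseChunks (suc k ∷ []) (s ++ []) ≡ reverse s
    reverseChunks-s = trans (reverseChunks-++ [] s [] ∣s∣) (++-identityʳ (reverse s))
  compatible-reverseRunsFrom E? c k (i ∷ w) s (b ∷ t) ∣s∣ ∣t∣ with c ≟ i
  ... | yes refl =
    subst₂ (λ π u → compatible E E? π u ≡ compatible (flip E) (flip E?) (reverseChunks ks π) u)
      (++-assoc s [ b ] t) (replicate-∷-++ (suc k) c w)
      (compatible-reverseRunsFrom E? c (suc k) w (s ++ [ b ]) t ∣s++b∣ (suc-injective ∣t∣))
    where
    ks = runLengthsFrom c (suc (suc k)) w
    ∣s++b∣ : length (s ++ [ b ]) ≡ suc (suc k)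
    ∣s++b∣ = trans (length-++-comm s [ b ]) (cong suc ∣s∣)
  ... | no c≢i = begin
    compatible E E? (s ++ b ∷ t) (run ++ i ∷ w)
      ≡⟨ compatible-++-run E? c≢i s (b ∷ t) ∣s∣ (λ ()) ⟩
    edgeFree E? s ∧ ((toℕ c ≤ᵇ toℕ i) ∧ compatible E E? (b ∷ t) (i ∷ w))
      ≡⟨ cong₂ (λ x y → x ∧ ((toℕ c ≤ᵇ toℕ i) ∧ y)) (sym (edgeFree-reverse (flip E?) s))
               (compatible-reverseRunsFrom E? i zero w [ b ] t refl (suc-injective ∣t∣)) ⟩
    edgeFree (flip E?) (reverse s) ∧ ((toℕ c ≤ᵇ toℕ i) ∧ compatible (flip E) (flip E?) rest (i ∷ w))
      ≡⟨ compatible-++-run (flip E?) c≢i (reverse s) rest ∣reverse-s∣ (reverseChunks-≢[] ks t) ⟨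
    compatible (flip E) (flip E?) (reverse s ++ rest) (run ++ i ∷ w)
      ≡⟨ cong (λ π → compatible (flip E) (flip E?) π (run ++ i ∷ w)) (reverseChunks-++ ks s (b ∷ t) ∣s∣) ⟨
    compatible (flip E) (flip E?) (reverseChunks (suc k ∷ ks) (s ++ b ∷ t)) (run ++ i ∷ w) ∎
    where
    run = replicate (suc k) c
    ks = runLengthsFrom i 1 w
    rest = reverseChunks ks (b ∷ t)
    ∣reverse-s∣ : length (reverse s) ≡ suc k
    ∣reverse-s∣ = trans (length-reverse s) ∣s∣

  compatible-reverseRuns : (E? : Decidable E) (w : List (Fin m)) (π : List (Fin n)) → length π ≡ length w →
    compatible E E? π w ≡ compatible (flip E) (flip E?) (reverseRuns w π) w
  compatible-reverseRuns E? [] [] _ = refl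
  compatible-reverseRuns E? (c ∷ w) (a ∷ π) ∣π∣ =
    compatible-reverseRunsFrom E? c zero w [ a ] π refl (suc-injective ∣π∣)

UCoeff-flip : {n : ℕ} {E : Fin n → Fin n → Set} (E? : Decidable E) (m : ℕ) (α : Fin m → ℕ) →
              UCoeff E E? m α ≡ UCoeff (flip E) (flip E?) m α
UCoeff-flip {n} E? m α =
  length-filterᵇ-involution pairs-unique swap-runs-∈ swap-runs-involutive compatible-swap-runs-∈
  where
  pairs = cartesianProduct (listings n) (words m n)
  swap-runs : List (Fin n) × List (Fin m) → List (Fin n) × List (Fin m)
  swap-runs (π , w) = reverseRuns w π , w
  pairs-unique : Unique pairs
  pairs-unique = cartesianProduct⁺ (perms-unique _≟_ (allFin n) (allFin⁺ n)) (words-unique m n)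
  swap-runs-∈ : ∀ {p} → p ∈ pairs → swap-runs p ∈ pairs
  swap-runs-∈ {π , w} p∈ with π∈ , w∈ ← ∈-cartesianProduct⁻ (listings n) (words m n) p∈ =
    ∈-cartesianProduct⁺
      (↭⇒∈-perms (allFin n) (↭-trans (reverseChunks-↭ (runLengths w) π) (∈-perms⇒↭ (allFin n) π∈))) w∈
  swap-runs-involutive : ∀ p → swap-runs (swap-runs p) ≡ p
  swap-runs-involutive (π , w) = cong (_, w) (reverseChunks-involutive (runLengths w) π)
  compatible-swap-runs-∈ : ∀ {p} → p ∈ pairs →
    compatible _ E? (proj₁ p) (proj₂ p) ∧ hasContent α (proj₂ p)
      ≡ compatible _ (flip E?) (proj₁ (swap-runs p)) (proj₂ (swap-runs p)) ∧ hasContent α (proj₂ p)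
  compatible-swap-runs-∈ {π , w} p∈ with π∈ , w∈ ← ∈-cartesianProduct⁻ (listings n) (words m n) p∈ =
    cong (_∧ hasContent α w)
      (compatible-reverseRuns E? w π (trans (length-listings n π∈) (sym (length-words m n w∈))))

compatible-cong : {n m : ℕ} {E F : Fin n → Fin n → Set} (E? : Decidable E) (F? : Decidable F) →
  (∀ a b → does (E? a b) ≡ does (F? a b)) → (π : List (Fin n)) (w : List (Fin m)) →
  compatible E E? π w ≡ compatible F F? π w
compatible-cong E? F? E≗F (a ∷ b ∷ π) (i ∷ j ∷ w) =
  cong₂ (λ d x → (if d then toℕ i <ᵇ toℕ j else toℕ i ≤ᵇ toℕ j) ∧ x)
        (E≗F a b) (compatible-cong E? F? E≗F (b ∷ π) (j ∷ w))
compatible-cong E? F? E≗F [] _ = refl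
compatible-cong E? F? E≗F (_ ∷ []) _ = refl
compatible-cong E? F? E≗F (_ ∷ _ ∷ _) [] = refl
compatible-cong E? F? E≗F (_ ∷ _ ∷ _) (_ ∷ []) = refl

UCoeff-cong : {n : ℕ} {E F : Fin n → Fin n → Set} (E? : Decidable E) (F? : Decidable F) →
  (∀ a b → does (E? a b) ≡ does (F? a b)) → (m : ℕ) (α : Fin m → ℕ) → UCoeff E E? m α ≡ UCoeff F F? m α
UCoeff-cong {n} E? F? E≗F m α =
  cong length (filterᵇ-cong-∈ (cartesianProduct (listings n) (words m n))
    (λ {(π , w)} _ → cong (_∧ hasContent α w) (compatible-cong E? F? E≗F π w)))

SameU-dual : (P : FinPoset) → SameU P (dual P)
SameU-dual P m α =
  trans (UCoeff-flip (StrictLt? P) m α) (UCoeff-cong _ (StrictLt? (dual P)) flip-strict m α)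
  where
  flip-strict : ∀ a b → does (StrictLt? P b a) ≡ does (StrictLt? (dual P) a b)
  flip-strict a b = cong (λ d → does (_≤P?_ P b a) ∧ not d) (does-≡ (b ≟ a) (map′ sym sym (a ≟ b)))

bottomedAntichain : ℕ → FinPoset
bottomedAntichain k = record
  { size  = suc k
  ; _≤P_  = _≼_
  ; isPO  = record
    { isPreorder = record { isEquivalence = isEquivalence ; reflexive = inj₁ ; trans = ≼-trans }
    ; antisym    = ≼-antisym
    }
  ; _≤P?_ = λ i j → (i ≟ j) ⊎-dec (i ≟ zero)
  }
  where
  _≼_ : Fin (suc k) → Fin (suc k) → Set
  i ≼ j = i ≡ j ⊎ i ≡ zero
  ≼-trans : ∀ {i j l} → i ≼ j → j ≼ l → i ≼ l
  ≼-trans (inj₁ refl) j≤l = j≤l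
  ≼-trans (inj₂ i≡0)  _   = inj₂ i≡0
  ≼-antisym : ∀ {i j} → i ≼ j → j ≼ i → i ≡ j
  ≼-antisym (inj₁ i≡j) _            = i≡j
  ≼-antisym (inj₂ _)   (inj₁ j≡i)   = sym j≡i
  ≼-antisym (inj₂ i≡0) (inj₂ j≡0)   = trans i≡0 (sym j≡0)

mainTheorem4 : ((P : FinPoset) → SameU P (dual P))
    × Σ FinPoset (λ P → Σ FinPoset (λ Q → SameU P Q × numMinimal P ≢ numMinimal Q))
    × Σ FinPoset (λ P → Σ FinPoset (λ Q → SameU P Q × numMaximal P ≢ numMaximal Q))
mainTheorem4 =
  SameU-dual ,
  (P₀ , dual P₀ , SameU-dual P₀ , λ ()) ,
  (P₀ , dual P₀ , SameU-dual P₀ , λ ())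
  where
  P₀ = bottomedAntichain 2
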